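{- Let $H$ be a finite graph and $a,b$ two vertices with $ab\notin E(H)$. Then $(-1)^{e(H)}$ times the coefficient of $p^2$ in the polynomial $4f_{a,b,H}(p)-(p-1)^{e(H)}$ is non-negative.
   Context: For $p\in[0,1]$ define the kernel $U_p:[0,1]^2\to\mathbb{R}$ by $U_p(x,y)=2p-1$ if $(x,y)\in[0,1/2)^2$ or $(x,y)\in[1/2,1]^2$, and $U_p(x,y)=-1$ otherwise. Let $I_1=[0,1/2)$. For a graph $H$ and vertices $a,b$ define $f_{a,b,H}(p)=\int_{I_1\times I_1}\left(\int_{[0,1]^{v(H)-2}}\prod_{uv\in E(H)}U_p(x_u,x_v)\prod_{k\in V(H)\setminus\{a,b\}}dx_k\right)dx_a\,dx_b$, a polynomial in $p$. -}

module Defs where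

open import Data.Bool using (Bool; true; false; if_then_else_)
open import Data.Nat as ℕ using (ℕ; zero; suc)
open import Data.Fin using (Fin; toℕ)
import Data.Fin as Fin
open import Data.List using (List; []; _∷_; map; foldr; concatMap; filter; length; allFin)
open import Data.Rational using (ℚ; 0ℚ; 1ℚ; ½; _+_; _*_; -_)
import Data.Nat.Properties as ℕP
open import Relation.Binary.PropositionalEquality using (_≡_)

-- Polynomials in one variable p with rational coefficients,
-- represented by coefficient lists (constant term first).

Poly : Set
Poly = List ℚ

constP : ℚ → Poly
constP c = c ∷ []

X : Poly
X = 0ℚ ∷ 1ℚ ∷ []

_+P_ : Poly → Poly → Poly
[] +P q = q
(a ∷ p) +P [] = a ∷ p
(a ∷ p) +P (b ∷ q) = (a + b) ∷ (p +P q)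

scaleP : ℚ → Poly → Poly
scaleP c p = map (c *_) p

_*P_ : Poly → Poly → Poly
[] *P q = []
(a ∷ p) *P q = scaleP a q +P (0ℚ ∷ (p *P q))

negP : Poly → Poly
negP = scaleP (- 1ℚ)

_-P_ : Poly → Poly → Poly
p -P q = p +P negP q

_^P_ : Poly → ℕ → Poly
p ^P zero = constP 1ℚ
p ^P suc e = p *P (p ^P e)

sumP : List Poly → Poly
sumP = foldr _+P_ []

prodP : List Poly → Poly
prodP = foldr _*P_ (constP 1ℚ)

coeff : Poly → ℕ → ℚ
coeff [] k = 0ℚ
coeff (a ∷ p) zero = a
coeff (a ∷ p) (suc k) = coeff p k

_^Q_ : ℚ → ℕ → ℚ
x ^Q zero = 1ℚ
x ^Q suc e = x * (x ^Q e)

record Graph (n : ℕ) : Set where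
  field
    adj    : Fin n → Fin n → Bool
    sym    : ∀ i j → adj i j ≡ adj j i
    irrefl : ∀ i → adj i i ≡ false
open Graph public

record Pair (n : ℕ) : Set where
  constructor _,,_
  field
    fst snd : Fin n

pairs< : (n : ℕ) → List (Pair n)
pairs< n = concatMap (λ i → map (λ j → i ,, j)
             (filter (λ j → toℕ i ℕP.<? toℕ j) (allFin n))) (allFin n)

edges : ∀ {n} → Graph n → List (Pair n)
edges {n} H = filter (λ e → Data.Bool._≟_ (adj H (Pair.fst e) (Pair.snd e)) true) (pairs< n)
  where import Data.Bool

e : ∀ {n} → Graph n → ℕ
e H = length (edges H)

-- The step kernel U_p.  A point x ∈ [0,1] is encoded by the part of
-- the partition {I₁ = [0,1/2), I₂ = [1/2,1]} containing it:
-- true = I₁, false = I₂.  U_p is constant on the four cells.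

Part : Set
Part = Bool

samePart : Part → Part → Bool
samePart true true = true
samePart false false = true
samePart _ _ = false

U : Part → Part → Poly
U s t = if samePart s t then (- 1ℚ) ∷ (1ℚ + 1ℚ) ∷ [] else constP (- 1ℚ)

assignments : (n : ℕ) → List (Fin n → Part)
assignments zero = (λ ()) ∷ []
assignments (suc n) =
  concatMap (λ σ → (λ { Fin.zero → true ; (Fin.suc i) → σ i })
                 ∷ (λ { Fin.zero → false ; (Fin.suc i) → σ i }) ∷ [])
            (assignments n)

-- Lebesgue measure of the cell (part) inside the integration domain of
-- one coordinate: for a, b the domain is I₁, for other vertices [0,1].
-- |I₁ ∩ I₁| = 1/2, |I₁ ∩ I₂| = 0, |[0,1] ∩ Iₖ| = 1/2.
cellMeasure : Bool → Part → ℚ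
cellMeasure restricted true = ½
cellMeasure true false = 0ℚ
cellMeasure false false = ½

isAB : ∀ {n} → Fin n → Fin n → Fin n → Bool
isAB a b k = if Data.Fin._≟_ k a .Relation.Nullary.Decidable.does then true
             else (Data.Fin._≟_ k b .Relation.Nullary.Decidable.does)
  where import Data.Fin
        import Relation.Nullary.Decidable

-- measure of the product cell determined by σ inside I₁ × I₁ × [0,1]^{v(H)-2}
weight : ∀ {n} → Fin n → Fin n → (Fin n → Part) → ℚ
weight {n} a b σ = foldr (λ k w → cellMeasure (isAB a b k) (σ k) * w) 1ℚ (allFin n)

integrand : ∀ {n} → Graph n → (Fin n → Part) → Poly
integrand H σ = prodP (map (λ e → U (σ (Pair.fst e)) (σ (Pair.snd e))) (edges H))

-- f_{a,b,H}(p): the integral of a step function = Σ over cells of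
-- (measure of cell) × (value on cell)
f : ∀ {n} → Fin n → Fin n → Graph n → Poly
f {n} a b H = sumP (map (λ σ → scaleP (weight a b σ) (integrand H σ)) (assignments n))

{-# OPTIONS --safe #-}
-- On each cell U_p = -1 + p (1 + χ(x) χ(y)), where χ is 1 on I₁ and -1 on I₂. Expanding the
-- product over the edges, (-1)^e(H) times the p² coefficient of ∏ U_p is the sum, over pairs of
-- edges, of the products of their slopes 1 + χ χ, while for (p - 1)^e(H) it is the number of pairs
-- of edges. So it suffices that every pair of edges uv, u′v′ has
--   ∫ (1 + χ(x_u) χ(x_v)) (1 + χ(x_u′) χ(x_v′)) ≥ 1/4   over I₁ × I₁ × [0,1]^(n-2).
-- Expanding the integrand, the constant term contributes the measure of the domain, at least 1/4,
-- and every other term is the integral of a character monomial, which factorises over the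
-- vertices into factors ½ ± ½ or ½ and is therefore nonnegative.
module Submission where

open import Defs hiding (sym)
open import Data.Nat using (ℕ; zero; suc)
open import Data.Fin using (Fin; zero; suc; _≟_)
open import Data.Bool using (true; false; if_then_else_)
open import Data.List using (List; []; _∷_; _++_; map; foldr; concatMap; length; tabulate)
open import Data.Product using (_×_; _,_; proj₂)
open import Data.Sum using (_⊎_; inj₁; inj₂)
open import Data.Rational using (ℚ; 0ℚ; 1ℚ; ½; _≤_; _≤?_; _*_; -_; _+_; nonNegative)
open import Data.Rational.Properties
  using (≤-refl; ≤-trans; +-mono-≤; +-monoˡ-≤; *-monoˡ-≤-nonNeg; *-monoʳ-≤-nonNeg; +-inverseʳ;
         +-identityˡ; +-identityʳ; *-identityˡ; *-identityʳ; *-zeroˡ; *-zeroʳ; *-distribˡ-+; +-assoc;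
         +-*-commutativeRing) renaming (_≟_ to _≟ℚ_)
open import Relation.Binary.PropositionalEquality
  using (_≡_; _≢_; refl; sym; trans; cong; cong₂; subst; subst₂; module ≡-Reasoning)
open import Relation.Nullary.Decidable using (does; True; toWitness; dec⇒maybe)
open import Tactic.RingSolver using (solve-∀)
import Tactic.RingSolver.Core.AlmostCommutativeRing as ACR

open ≡-Reasoning

private
  variable
    A B : Set
    n : ℕ

ℚ-ring : ACR.AlmostCommutativeRing _ _
ℚ-ring = ACR.fromCommutativeRing +-*-commutativeRing (λ x → dec⇒maybe (0ℚ ≟ℚ x))

≤-by-computation : {p q : ℚ} {p≤q : True (p ≤? q)} → p ≤ q
≤-by-computation {p≤q = p≤q} = toWitness p≤q

p≤q⇒0≤q-p : {p q : ℚ} → p ≤ q → 0ℚ ≤ q + - p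
p≤q⇒0≤q-p {p} {q} p≤q = subst (_≤ q + - p) (+-inverseʳ p) (+-monoˡ-≤ (- p) p≤q)

four : ℚ
four = 1ℚ + 1ℚ + 1ℚ + 1ℚ

-- Sums over lists and over pairs of list elements

∑ : List A → (A → ℚ) → ℚ
∑ [] g = 0ℚ
∑ (x ∷ xs) g = g x + ∑ xs g

∑-cong : (xs : List A) {g h : A → ℚ} → (∀ x → g x ≡ h x) → ∑ xs g ≡ ∑ xs h
∑-cong [] eq = refl
∑-cong (x ∷ xs) eq = cong₂ _+_ (eq x) (∑-cong xs eq)

∑-zero : (xs : List A) → ∑ xs (λ _ → 0ℚ) ≡ 0ℚ
∑-zero [] = refl
∑-zero (x ∷ xs) = trans (+-identityˡ _) (∑-zero xs)

∑-+ : (xs : List A) (g h : A → ℚ) → ∑ xs (λ x → g x + h x) ≡ ∑ xs g + ∑ xs h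
∑-+ [] g h = refl
∑-+ (x ∷ xs) g h = trans (cong (g x + h x +_) (∑-+ xs g h)) (interchange (g x) (h x) (∑ xs g) (∑ xs h))
  where
  interchange : ∀ a b c d → (a + b) + (c + d) ≡ (a + c) + (b + d)
  interchange = solve-∀ ℚ-ring

∑-*ˡ : (xs : List A) (c : ℚ) (g : A → ℚ) → ∑ xs (λ x → c * g x) ≡ c * ∑ xs g
∑-*ˡ [] c g = sym (*-zeroʳ c)
∑-*ˡ (x ∷ xs) c g = trans (cong (c * g x +_) (∑-*ˡ xs c g)) (sym (*-distribˡ-+ c (g x) (∑ xs g)))

∑-mono-≤ : (xs : List A) {g h : A → ℚ} → (∀ x → g x ≤ h x) → ∑ xs g ≤ ∑ xs h
∑-mono-≤ [] g≤h = ≤-refl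
∑-mono-≤ (x ∷ xs) g≤h = +-mono-≤ (g≤h x) (∑-mono-≤ xs g≤h)

∑-comm : (xs : List A) (ys : List B) (G : A → B → ℚ) →
         ∑ xs (λ x → ∑ ys (G x)) ≡ ∑ ys (λ y → ∑ xs (λ x → G x y))
∑-comm [] ys G = sym (∑-zero ys)
∑-comm (x ∷ xs) ys G =
  trans (cong (∑ ys (G x) +_) (∑-comm xs ys G)) (sym (∑-+ ys (G x) (λ y → ∑ xs (λ x′ → G x′ y))))

∑-++ : (xs ys : List A) (g : A → ℚ) → ∑ (xs ++ ys) g ≡ ∑ xs g + ∑ ys g
∑-++ [] ys g = sym (+-identityˡ _)
∑-++ (x ∷ xs) ys g = trans (cong (g x +_) (∑-++ xs ys g)) (sym (+-assoc (g x) (∑ xs g) (∑ ys g)))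

∑-concatMap : (h : A → List B) (xs : List A) (g : B → ℚ) →
              ∑ (concatMap h xs) g ≡ ∑ xs (λ x → ∑ (h x) g)
∑-concatMap h [] g = refl
∑-concatMap h (x ∷ xs) g = trans (∑-++ (h x) (concatMap h xs) g) (cong (∑ (h x) g +_) (∑-concatMap h xs g))

pairSum : (A → A → ℚ) → List A → ℚ
pairSum D [] = 0ℚ
pairSum D (x ∷ xs) = ∑ xs (D x) + pairSum D xs

pairSum-mono-≤ : (xs : List A) {D D′ : A → A → ℚ} → (∀ x y → D x y ≤ D′ x y) →
                 pairSum D xs ≤ pairSum D′ xs
pairSum-mono-≤ [] D≤D′ = ≤-refl
pairSum-mono-≤ (x ∷ xs) D≤D′ = +-mono-≤ (∑-mono-≤ xs (D≤D′ x)) (pairSum-mono-≤ xs D≤D′)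

pairSum-*ˡ : (c : ℚ) (D : A → A → ℚ) (xs : List A) → pairSum (λ x y → c * D x y) xs ≡ c * pairSum D xs
pairSum-*ˡ c D [] = sym (*-zeroʳ c)
pairSum-*ˡ c D (x ∷ xs) =
  trans (cong₂ _+_ (∑-*ˡ xs c (D x)) (pairSum-*ˡ c D xs)) (sym (*-distribˡ-+ c (∑ xs (D x)) (pairSum D xs)))

∑-pairSum : (zs : List B) (K : B → A → A → ℚ) (xs : List A) →
            ∑ zs (λ z → pairSum (K z) xs) ≡ pairSum (λ x y → ∑ zs (λ z → K z x y)) xs
∑-pairSum zs K [] = ∑-zero zs
∑-pairSum zs K (x ∷ xs) = begin
  ∑ zs (λ z → ∑ xs (K z x) + pairSum (K z) xs)
    ≡⟨ ∑-+ zs _ _ ⟩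
  ∑ zs (λ z → ∑ xs (K z x)) + ∑ zs (λ z → pairSum (K z) xs)
    ≡⟨ cong₂ _+_ (∑-comm zs xs (λ z → K z x)) (∑-pairSum zs K xs) ⟩
  ∑ xs (λ y → ∑ zs (λ z → K z x y)) + pairSum (λ x y → ∑ zs (λ z → K z x y)) xs ∎

-- Products over the vertices

∏ : (n : ℕ) → (Fin n → ℚ) → ℚ
∏ zero g = 1ℚ
∏ (suc n) g = g zero * ∏ n (λ k → g (suc k))

∏-cong : ∀ n {g h : Fin n → ℚ} → (∀ k → g k ≡ h k) → ∏ n g ≡ ∏ n h
∏-cong zero eq = refl
∏-cong (suc n) eq = cong₂ _*_ (eq zero) (∏-cong n (λ k → eq (suc k)))

∏-one : ∀ n → ∏ n (λ _ → 1ℚ) ≡ 1ℚ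
∏-one zero = refl
∏-one (suc n) = trans (*-identityˡ _) (∏-one n)

∏-nonneg : ∀ n {g : Fin n → ℚ} → (∀ k → 0ℚ ≤ g k) → 0ℚ ≤ ∏ n g
∏-nonneg zero 0≤g = ≤-by-computation
∏-nonneg (suc n) {g} 0≤g = subst (_≤ g zero * ∏ n (λ k → g (suc k))) (*-zeroʳ (g zero))
  (*-monoˡ-≤-nonNeg (g zero) {{nonNegative (0≤g zero)}} (∏-nonneg n (λ k → 0≤g (suc k))))

∏-mono-≤ : ∀ n {g h : Fin n → ℚ} → (∀ k → 0ℚ ≤ g k) → (∀ k → g k ≤ h k) → ∏ n g ≤ ∏ n h
∏-mono-≤ zero 0≤g g≤h = ≤-refl
∏-mono-≤ (suc n) {g} {h} 0≤g g≤h = ≤-trans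
  (*-monoʳ-≤-nonNeg (∏ n (λ k → g (suc k))) {{nonNegative (∏-nonneg n (λ k → 0≤g (suc k)))}} (g≤h zero))
  (*-monoˡ-≤-nonNeg (h zero) {{nonNegative (≤-trans (0≤g zero) (g≤h zero))}}
    (∏-mono-≤ n (λ k → 0≤g (suc k)) (λ k → g≤h (suc k))))

∏-*-at : ∀ n (g c : Fin n → ℚ) (u : Fin n) →
         ∏ n (λ k → g k * (if does (k ≟ u) then c k else 1ℚ)) ≡ ∏ n g * c u
∏-*-at (suc n) g c zero =
  trans (cong (g zero * c zero *_) (∏-cong n (λ k → *-identityʳ (g (suc k))))) (swap₂₃ (g zero) (c zero) _)
  where
  swap₂₃ : ∀ x y z → (x * y) * z ≡ (x * z) * y
  swap₂₃ = solve-∀ ℚ-ring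
∏-*-at (suc n) g c (suc u) =
  trans (cong₂ _*_ (*-identityʳ (g zero)) (∏-*-at n (λ k → g (suc k)) (λ k → c (suc k)) u))
        (reassoc (g zero) _ (c (suc u)))
  where
  reassoc : ∀ x y z → x * (y * z) ≡ (x * y) * z
  reassoc = solve-∀ ℚ-ring

foldr-tabulate : ∀ {m} n (g : Fin m → ℚ) (t : Fin n → Fin m) →
                 foldr (λ k w → g k * w) 1ℚ (tabulate t) ≡ ∏ n (λ k → g (t k))
foldr-tabulate zero g t = refl
foldr-tabulate (suc n) g t = cong (g (t zero) *_) (foldr-tabulate n g (λ k → t (suc k)))

∑-assignments-∏ : ∀ n (h : Fin n → Part → ℚ) →
                  ∑ (assignments n) (λ σ → ∏ n (λ k → h k (σ k))) ≡ ∏ n (λ k → h k true + h k false)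
∑-assignments-∏ zero h = refl
∑-assignments-∏ (suc n) h = begin
  ∑ (assignments (suc n)) (λ σ → ∏ (suc n) (λ k → h k (σ k)))
    ≡⟨ ∑-concatMap _ (assignments n) _ ⟩
  ∑ (assignments n) (λ σ → h zero true * rest σ + (h zero false * rest σ + 0ℚ))
    ≡⟨ ∑-cong (assignments n) (λ σ → factor (h zero true) (h zero false) (rest σ)) ⟩
  ∑ (assignments n) (λ σ → (h zero true + h zero false) * rest σ)
    ≡⟨ ∑-*ˡ (assignments n) (h zero true + h zero false) rest ⟩
  (h zero true + h zero false) * ∑ (assignments n) rest
    ≡⟨ cong ((h zero true + h zero false) *_) (∑-assignments-∏ n (λ k → h (suc k))) ⟩
  ∏ (suc n) (λ k → h k true + h k false) ∎
  where
  rest : (Fin n → Part) → ℚ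
  rest σ = ∏ n (λ k → h (suc k) (σ k))
  factor : ∀ x y r → x * r + (y * r + 0ℚ) ≡ (x + y) * r
  factor = solve-∀ ℚ-ring

weight≡∏ : (a b : Fin n) (σ : Fin n → Part) → weight a b σ ≡ ∏ n (λ k → cellMeasure (isAB a b k) (σ k))
weight≡∏ {n} a b σ = foldr-tabulate n (λ k → cellMeasure (isAB a b k) (σ k)) (λ k → k)

-- Low coefficients of polynomials

coeff-+P : ∀ p q k → coeff (p +P q) k ≡ coeff p k + coeff q k
coeff-+P [] q k = sym (+-identityˡ (coeff q k))
coeff-+P (a ∷ p) [] k = sym (+-identityʳ (coeff (a ∷ p) k))
coeff-+P (a ∷ p) (b ∷ q) zero = refl
coeff-+P (a ∷ p) (b ∷ q) (suc k) = coeff-+P p q k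

coeff-scaleP : ∀ c p k → coeff (scaleP c p) k ≡ c * coeff p k
coeff-scaleP c [] k = sym (*-zeroʳ c)
coeff-scaleP c (a ∷ p) zero = refl
coeff-scaleP c (a ∷ p) (suc k) = coeff-scaleP c p k

coeff-sumP : (G : A → Poly) (xs : List A) (k : ℕ) → coeff (sumP (map G xs)) k ≡ ∑ xs (λ x → coeff (G x) k)
coeff-sumP G [] k = refl
coeff-sumP G (x ∷ xs) k = trans (coeff-+P (G x) (sumP (map G xs)) k) (cong (coeff (G x) k +_) (coeff-sumP G xs k))

coeff-*P-suc : ∀ a p q k → coeff ((a ∷ p) *P q) (suc k) ≡ a * coeff q (suc k) + coeff (p *P q) k
coeff-*P-suc a p q k = trans (coeff-+P (scaleP a q) (0ℚ ∷ (p *P q)) (suc k))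
  (cong (_+ coeff (p *P q) k) (coeff-scaleP a q (suc k)))

coeff₀-*P : ∀ p q → coeff (p *P q) 0 ≡ coeff p 0 * coeff q 0
coeff₀-*P [] q = sym (*-zeroˡ (coeff q 0))
coeff₀-*P (a ∷ p) q = trans (coeff-+P (scaleP a q) (0ℚ ∷ (p *P q)) 0) (trans (+-identityʳ _) (coeff-scaleP a q 0))

coeff₁-*P : ∀ p q → coeff (p *P q) 1 ≡ coeff p 0 * coeff q 1 + coeff p 1 * coeff q 0
coeff₁-*P [] q = zeros (coeff q 1) (coeff q 0)
  where
  zeros : ∀ x y → 0ℚ ≡ 0ℚ * x + 0ℚ * y
  zeros = solve-∀ ℚ-ring
coeff₁-*P (a ∷ p) q = trans (coeff-*P-suc a p q 0) (cong (a * coeff q 1 +_) (coeff₀-*P p q))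

coeff₂-*P : ∀ p q → coeff (p *P q) 2 ≡ coeff p 0 * coeff q 2 + (coeff p 1 * coeff q 1 + coeff p 2 * coeff q 0)
coeff₂-*P [] q = zeros (coeff q 2) (coeff q 1) (coeff q 0)
  where
  zeros : ∀ x y z → 0ℚ ≡ 0ℚ * x + (0ℚ * y + 0ℚ * z)
  zeros = solve-∀ ℚ-ring
coeff₂-*P (a ∷ p) q = trans (coeff-*P-suc a p q 1) (cong (a * coeff q 2 +_) (coeff₁-*P p q))

ε : ℕ → ℚ
ε m = (- 1ℚ) ^Q m

ε-square : ∀ m → ε m * ε m ≡ 1ℚ
ε-square zero = refl
ε-square (suc m) = trans (signs (ε m)) (ε-square m)
  where
  signs : ∀ x → (- 1ℚ * x) * (- 1ℚ * x) ≡ x * x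
  signs = solve-∀ ℚ-ring

module _ (q : A → Poly) (q₀ : ∀ x → coeff (q x) 0 ≡ - 1ℚ) (q₂ : ∀ x → coeff (q x) 2 ≡ 0ℚ) where

  private
    c : A → ℚ
    c x = coeff (q x) 1

  lowCoeffs-prodP : (xs : List A) →
      coeff (prodP (map q xs)) 0 ≡ ε (length xs)
    × coeff (prodP (map q xs)) 1 ≡ - (ε (length xs) * ∑ xs c)
    × coeff (prodP (map q xs)) 2 ≡ ε (length xs) * pairSum (λ x y → c x * c y) xs
  lowCoeffs-prodP [] = refl , refl , refl
  lowCoeffs-prodP (x ∷ xs) with lowCoeffs-prodP xs
  ... | π₀ , π₁ , π₂ =
    trans (coeff₀-*P (q x) π) (cong₂ _*_ (q₀ x) π₀) ,
    trans (coeff₁-*P (q x) π) (trans (cong₂ _+_ (cong₂ _*_ (q₀ x) π₁) (cong (c x *_) π₀))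
                                     (step₁ (ε (length xs)) (∑ xs c) (c x))) ,
    trans (coeff₂-*P (q x) π)
      (trans (cong₂ _+_ (cong₂ _*_ (q₀ x) π₂) (cong₂ _+_ (cong (c x *_) π₁) (cong₂ _*_ (q₂ x) π₀)))
        (trans (step₂ (ε (length xs)) (∑ xs c) (pairSum (λ x y → c x * c y) xs) (c x))
               (cong (λ s → - 1ℚ * ε (length xs) * (s + pairSum (λ x y → c x * c y) xs)) (sym (∑-*ˡ xs (c x) c)))))
    where
    π : Poly
    π = prodP (map q xs)
    step₁ : ∀ E S y → - 1ℚ * - (E * S) + y * E ≡ - ((- 1ℚ * E) * (y + S))
    step₁ = solve-∀ ℚ-ring
    step₂ : ∀ E S P y → - 1ℚ * (E * P) + (y * - (E * S) + 0ℚ * E) ≡ (- 1ℚ * E) * (y * S + P)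
    step₂ = solve-∀ ℚ-ring

  coeff₂-prodP : (xs : List A) → coeff (prodP (map q xs)) 2 ≡ ε (length xs) * pairSum (λ x y → c x * c y) xs
  coeff₂-prodP xs = proj₂ (proj₂ (lowCoeffs-prodP xs))

^P-length : ∀ p (xs : List A) → p ^P length xs ≡ prodP (map (λ _ → p) xs)
^P-length p [] = refl
^P-length p (x ∷ xs) = cong (p *P_) (^P-length p xs)

coeff₂-[X-1]^length : (xs : List A) →
  coeff ((X -P constP 1ℚ) ^P length xs) 2 ≡ ε (length xs) * pairSum (λ _ _ → 1ℚ) xs
coeff₂-[X-1]^length xs = trans (cong (λ p → coeff p 2) (^P-length (X -P constP 1ℚ) xs))
                             (coeff₂-prodP (λ _ → X -P constP 1ℚ) (λ _ → refl) (λ _ → refl) xs)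

-- The kernel and the characters of the partition

χ : Part → ℚ
χ true = 1ℚ
χ false = - 1ℚ

coeff₀-U : ∀ s t → coeff (U s t) 0 ≡ - 1ℚ
coeff₀-U true true = refl
coeff₀-U true false = refl
coeff₀-U false true = refl
coeff₀-U false false = refl

coeff₁-U : ∀ s t → coeff (U s t) 1 ≡ 1ℚ + χ s * χ t
coeff₁-U true true = refl
coeff₁-U true false = refl
coeff₁-U false true = refl
coeff₁-U false false = refl

coeff₂-U : ∀ s t → coeff (U s t) 2 ≡ 0ℚ
coeff₂-U true true = refl
coeff₂-U true false = refl
coeff₂-U false true = refl
coeff₂-U false false = refl

slope : (Fin n → Part) → Pair n → ℚ
slope σ x = coeff (U (σ (Pair.fst x)) (σ (Pair.snd x))) 1

coeff₂-integrand : (H : Graph n) (σ : Fin n → Part) →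
                   coeff (integrand H σ) 2 ≡ ε (e H) * pairSum (λ x y → slope σ x * slope σ y) (edges H)
coeff₂-integrand H σ =
  coeff₂-prodP (λ x → U (σ (Pair.fst x)) (σ (Pair.snd x))) (λ x → coeff₀-U (σ (Pair.fst x)) (σ (Pair.snd x)))
    (λ x → coeff₂-U (σ (Pair.fst x)) (σ (Pair.snd x))) (edges H)

χ-monomial : (Fin n → Part) → List (Fin n) → ℚ
χ-monomial σ [] = 1ℚ
χ-monomial σ (u ∷ us) = χ (σ u) * χ-monomial σ us

χ-factor : List (Fin n) → Fin n → Part → ℚ
χ-factor [] k t = 1ℚ
χ-factor (u ∷ us) k t = (if does (k ≟ u) then χ t else 1ℚ) * χ-factor us k t

∏-χ-factor : (g : Fin n → ℚ) (us : List (Fin n)) (σ : Fin n → Part) →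
             ∏ n (λ k → g k * χ-factor us k (σ k)) ≡ ∏ n g * χ-monomial σ us
∏-χ-factor {n} g [] σ = trans (∏-cong n (λ k → *-identityʳ (g k))) (sym (*-identityʳ (∏ n g)))
∏-χ-factor {n} g (u ∷ us) σ = begin
  ∏ n (λ k → g k * ((if does (k ≟ u) then χ (σ k) else 1ℚ) * χ-factor us k (σ k)))
    ≡⟨ ∏-cong n (λ k → pull (g k) (if does (k ≟ u) then χ (σ k) else 1ℚ) (χ-factor us k (σ k))) ⟩
  ∏ n (λ k → (g k * χ-factor us k (σ k)) * (if does (k ≟ u) then χ (σ k) else 1ℚ))
    ≡⟨ ∏-*-at n (λ k → g k * χ-factor us k (σ k)) (λ k → χ (σ k)) u ⟩
  ∏ n (λ k → g k * χ-factor us k (σ k)) * χ (σ u)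
    ≡⟨ cong (_* χ (σ u)) (∏-χ-factor g us σ) ⟩
  (∏ n g * χ-monomial σ us) * χ (σ u)
    ≡⟨ push (∏ n g) (χ-monomial σ us) (χ (σ u)) ⟩
  ∏ n g * χ-monomial σ (u ∷ us) ∎
  where
  pull : ∀ x y z → x * (y * z) ≡ (x * z) * y
  pull = solve-∀ ℚ-ring
  push : ∀ x y z → (x * y) * z ≡ x * (z * y)
  push = solve-∀ ℚ-ring

χ-factor-true : (us : List (Fin n)) (k : Fin n) → χ-factor us k true ≡ 1ℚ
χ-factor-true [] k = refl
χ-factor-true (u ∷ us) k with does (k ≟ u)
... | true = trans (*-identityˡ _) (χ-factor-true us k)
... | false = trans (*-identityˡ _) (χ-factor-true us k)

IsSign : ℚ → Set
IsSign x = x ≡ 1ℚ ⊎ x ≡ - 1ℚ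

IsSign-* : {x y : ℚ} → IsSign x → IsSign y → IsSign (x * y)
IsSign-* (inj₁ refl) (inj₁ refl) = inj₁ refl
IsSign-* (inj₁ refl) (inj₂ refl) = inj₂ refl
IsSign-* (inj₂ refl) (inj₁ refl) = inj₂ refl
IsSign-* (inj₂ refl) (inj₂ refl) = inj₁ refl

χ-factor-false : (us : List (Fin n)) (k : Fin n) → IsSign (χ-factor us k false)
χ-factor-false [] k = inj₁ refl
χ-factor-false (u ∷ us) k with does (k ≟ u)
... | true = IsSign-* (inj₂ refl) (χ-factor-false us k)
... | false = IsSign-* (inj₁ refl) (χ-factor-false us k)

cellMeasure-signed-nonneg : ∀ r {s} → IsSign s → 0ℚ ≤ cellMeasure r true * 1ℚ + cellMeasure r false * s
cellMeasure-signed-nonneg true (inj₁ refl) = ≤-by-computation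
cellMeasure-signed-nonneg true (inj₂ refl) = ≤-by-computation
cellMeasure-signed-nonneg false (inj₁ refl) = ≤-by-computation
cellMeasure-signed-nonneg false (inj₂ refl) = ≤-by-computation

-- Integrals of character monomials

module _ {n : ℕ} (a b : Fin n) where

  characterSum : List (Fin n) → ℚ
  characterSum us = ∑ (assignments n) (λ σ → weight a b σ * χ-monomial σ us)

  private
    μ : Fin n → Part → ℚ
    μ k t = cellMeasure (isAB a b k) t

  characterSum≡∏ : (us : List (Fin n)) →
    characterSum us ≡ ∏ n (λ k → μ k true * χ-factor us k true + μ k false * χ-factor us k false)
  characterSum≡∏ us = begin
    ∑ (assignments n) (λ σ → weight a b σ * χ-monomial σ us)
      ≡⟨ ∑-cong (assignments n) (λ σ → cong (_* χ-monomial σ us) (weight≡∏ a b σ)) ⟩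
    ∑ (assignments n) (λ σ → ∏ n (λ k → μ k (σ k)) * χ-monomial σ us)
      ≡⟨ ∑-cong (assignments n) (λ σ → sym (∏-χ-factor (λ k → μ k (σ k)) us σ)) ⟩
    ∑ (assignments n) (λ σ → ∏ n (λ k → μ k (σ k) * χ-factor us k (σ k)))
      ≡⟨ ∑-assignments-∏ n (λ k t → μ k t * χ-factor us k t) ⟩
    ∏ n (λ k → μ k true * χ-factor us k true + μ k false * χ-factor us k false) ∎

  characterSum-nonneg : (us : List (Fin n)) → 0ℚ ≤ characterSum us
  characterSum-nonneg us = subst (0ℚ ≤_) (sym (characterSum≡∏ us)) (∏-nonneg n factor-nonneg)
    where
    factor-nonneg : ∀ k → 0ℚ ≤ μ k true * χ-factor us k true + μ k false * χ-factor us k false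
    factor-nonneg k = subst (λ s → 0ℚ ≤ μ k true * s + μ k false * χ-factor us k false) (sym (χ-factor-true us k))
                            (cellMeasure-signed-nonneg (isAB a b k) (χ-factor-false us k))

  ¼≤characterSum-[] : ½ * ½ ≤ characterSum []
  ¼≤characterSum-[] = subst₂ _≤_ corners (sym (characterSum≡∏ []))
    (∏-mono-≤ n (λ k → corner-nonneg (does (k ≟ a)) (does (k ≟ b))) corner≤μ)
    where
    half-at : Fin n → Fin n → ℚ
    half-at u k = if does (k ≟ u) then ½ else 1ℚ
    corner-nonneg : ∀ x y → 0ℚ ≤ (if x then ½ else 1ℚ) * (if y then ½ else 1ℚ)
    corner-nonneg true true = ≤-by-computation
    corner-nonneg true false = ≤-by-computation
    corner-nonneg false true = ≤-by-computation
    corner-nonneg false false = ≤-by-computation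
    corner≤μ : ∀ k → half-at a k * half-at b k ≤ μ k true * 1ℚ + μ k false * 1ℚ
    corner≤μ k with does (k ≟ a) | does (k ≟ b)
    ... | true | true = ≤-by-computation
    ... | true | false = ≤-by-computation
    ... | false | true = ≤-by-computation
    ... | false | false = ≤-by-computation
    corners : ∏ n (λ k → half-at a k * half-at b k) ≡ ½ * ½
    corners = begin
      ∏ n (λ k → half-at a k * half-at b k)
        ≡⟨ ∏-*-at n (half-at a) (λ _ → ½) b ⟩
      ∏ n (half-at a) * ½
        ≡⟨ cong (_* ½) (∏-cong n (λ k → sym (*-identityˡ (half-at a k)))) ⟩
      ∏ n (λ k → 1ℚ * half-at a k) * ½
        ≡⟨ cong (_* ½) (∏-*-at n (λ _ → 1ℚ) (λ _ → ½) a) ⟩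
      (∏ n (λ _ → 1ℚ) * ½) * ½
        ≡⟨ cong (λ x → x * ½ * ½) (∏-one n) ⟩
      ½ * ½ ∎

  jointSlope : Pair n → Pair n → ℚ
  jointSlope x y = ∑ (assignments n) (λ σ → weight a b σ * (slope σ x * slope σ y))

  jointSlope≡characterSums : (u v u′ v′ : Fin n) →
    jointSlope (u ,, v) (u′ ,, v′) ≡ characterSum [] + (characterSum (u ∷ v ∷ []) + (characterSum (u′ ∷ v′ ∷ [])
                                                      + characterSum (u ∷ v ∷ u′ ∷ v′ ∷ [])))
  jointSlope≡characterSums u v u′ v′ = begin
    ∑ cells (λ σ → weight a b σ * (slope σ (u ,, v) * slope σ (u′ ,, v′)))
      ≡⟨ ∑-cong cells (λ σ → cong (weight a b σ *_) (cong₂ _*_ (coeff₁-U (σ u) (σ v)) (coeff₁-U (σ u′) (σ v′)))) ⟩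
    ∑ cells (λ σ → weight a b σ * ((1ℚ + χ (σ u) * χ (σ v)) * (1ℚ + χ (σ u′) * χ (σ v′))))
      ≡⟨ ∑-cong cells (λ σ → expand (weight a b σ) (χ (σ u)) (χ (σ v)) (χ (σ u′)) (χ (σ v′))) ⟩
    ∑ cells (λ σ → term σ [] + (term σ (u ∷ v ∷ []) + (term σ (u′ ∷ v′ ∷ []) + term σ (u ∷ v ∷ u′ ∷ v′ ∷ []))))
      ≡⟨ ∑-+ cells _ _ ⟩
    characterSum [] + ∑ cells (λ σ → term σ (u ∷ v ∷ []) + (term σ (u′ ∷ v′ ∷ []) + term σ (u ∷ v ∷ u′ ∷ v′ ∷ [])))
      ≡⟨ cong (characterSum [] +_) (trans (∑-+ cells _ _) (cong (characterSum (u ∷ v ∷ []) +_) (∑-+ cells _ _))) ⟩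
    characterSum [] + (characterSum (u ∷ v ∷ []) + (characterSum (u′ ∷ v′ ∷ []) + characterSum (u ∷ v ∷ u′ ∷ v′ ∷ []))) ∎
    where
    cells : List (Fin n → Part)
    cells = assignments n
    term : (Fin n → Part) → List (Fin n) → ℚ
    term σ us = weight a b σ * χ-monomial σ us
    expand : ∀ w p q r s → w * ((1ℚ + p * q) * (1ℚ + r * s))
           ≡ w * 1ℚ + (w * (p * (q * 1ℚ)) + (w * (r * (s * 1ℚ)) + w * (p * (q * (r * (s * 1ℚ))))))
    expand = solve-∀ ℚ-ring

  1≤4*jointSlope : (x y : Pair n) → 1ℚ ≤ four * jointSlope x y
  1≤4*jointSlope (u ,, v) (u′ ,, v′) =
    subst (λ J → 1ℚ ≤ four * J) (sym (jointSlope≡characterSums u v u′ v′))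
      (≤-trans ≤-by-computation
        (*-monoˡ-≤-nonNeg four
          (+-mono-≤ ¼≤characterSum-[]
            (+-mono-≤ (characterSum-nonneg (u ∷ v ∷ []))
              (+-mono-≤ (characterSum-nonneg (u′ ∷ v′ ∷ [])) (characterSum-nonneg (u ∷ v ∷ u′ ∷ v′ ∷ [])))))))

coeff₂-f : (a b : Fin n) (H : Graph n) → coeff (f a b H) 2 ≡ ε (e H) * pairSum (jointSlope a b) (edges H)
coeff₂-f {n} a b H = begin
  coeff (f a b H) 2
    ≡⟨ coeff-sumP _ cells 2 ⟩
  ∑ cells (λ σ → coeff (scaleP (weight a b σ) (integrand H σ)) 2)
    ≡⟨ ∑-cong cells (λ σ → trans (coeff-scaleP (weight a b σ) (integrand H σ) 2)
                              (cong (weight a b σ *_) (coeff₂-integrand H σ))) ⟩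
  ∑ cells (λ σ → weight a b σ * (ε (e H) * pairSum (S σ) (edges H)))
    ≡⟨ ∑-cong cells (λ σ → trans (swap (weight a b σ) (ε (e H)) _)
                              (cong (ε (e H) *_) (sym (pairSum-*ˡ (weight a b σ) (S σ) (edges H))))) ⟩
  ∑ cells (λ σ → ε (e H) * pairSum (λ x y → weight a b σ * S σ x y) (edges H))
    ≡⟨ ∑-*ˡ cells (ε (e H)) _ ⟩
  ε (e H) * ∑ cells (λ σ → pairSum (λ x y → weight a b σ * S σ x y) (edges H))
    ≡⟨ cong (ε (e H) *_) (∑-pairSum cells (λ σ x y → weight a b σ * S σ x y) (edges H)) ⟩
  ε (e H) * pairSum (jointSlope a b) (edges H) ∎
  where
  cells : List (Fin n → Part)
  cells = assignments n
  S : (Fin n → Part) → Pair n → Pair n → ℚ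
  S σ x y = slope σ x * slope σ y
  swap : ∀ x y z → x * (y * z) ≡ y * (x * z)
  swap = solve-∀ ℚ-ring

signed-coeff₂ : (a b : Fin n) (H : Graph n) →
  ε (e H) * coeff (scaleP four (f a b H) -P ((X -P constP 1ℚ) ^P e H)) 2
    ≡ four * pairSum (jointSlope a b) (edges H) + - pairSum (λ _ _ → 1ℚ) (edges H)
signed-coeff₂ a b H = begin
  ε m * coeff (scaleP four (f a b H) -P ((X -P constP 1ℚ) ^P m)) 2
    ≡⟨ cong (ε m *_) (coeff-+P (scaleP four (f a b H)) (negP ((X -P constP 1ℚ) ^P m)) 2) ⟩
  ε m * (coeff (scaleP four (f a b H)) 2 + coeff (negP ((X -P constP 1ℚ) ^P m)) 2)
    ≡⟨ cong (ε m *_) (cong₂ _+_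
         (trans (coeff-scaleP four (f a b H) 2) (cong (four *_) (coeff₂-f a b H)))
         (trans (coeff-scaleP (- 1ℚ) ((X -P constP 1ℚ) ^P m) 2) (cong (- 1ℚ *_) (coeff₂-[X-1]^length (edges H))))) ⟩
  ε m * (four * (ε m * PJ) + - 1ℚ * (ε m * P₁))
    ≡⟨ factor-sign (ε m) PJ P₁ ⟩
  (ε m * ε m) * (four * PJ + - P₁)
    ≡⟨ trans (cong (_* (four * PJ + - P₁)) (ε-square m)) (*-identityˡ _) ⟩
  four * PJ + - P₁ ∎
  where
  m : ℕ
  m = e H
  PJ P₁ : ℚ
  PJ = pairSum (jointSlope a b) (edges H)
  P₁ = pairSum (λ _ _ → 1ℚ) (edges H)
  factor-sign : ∀ E x y → E * (four * (E * x) + - 1ℚ * (E * y)) ≡ (E * E) * (four * x + - y)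
  factor-sign = solve-∀ ℚ-ring

lemma3p6 : (n : ℕ) (H : Graph n) (a b : Fin n) → a ≢ b → adj H a b ≡ false →
    0ℚ ≤ ((- 1ℚ) ^Q e H) * coeff (scaleP (1ℚ + 1ℚ + 1ℚ + 1ℚ) (f a b H) -P ((X -P constP 1ℚ) ^P e H)) 2
lemma3p6 n H a b _ _ = subst (0ℚ ≤_) (sym (signed-coeff₂ a b H)) (p≤q⇒0≤q-p pairs≤4*jointSlopes)
  where
  pairs≤4*jointSlopes : pairSum (λ _ _ → 1ℚ) (edges H) ≤ four * pairSum (jointSlope a b) (edges H)
  pairs≤4*jointSlopes = subst (pairSum (λ _ _ → 1ℚ) (edges H) ≤_) (pairSum-*ˡ four (jointSlope a b) (edges H))
                              (pairSum-mono-≤ (edges H) (1≤4*jointSlope a b))
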